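{- Let $a,b,c\in\mathbb{N}$ with $a\le b\le c$, $3a\ge b+c$, $a+b+c\equiv 0$ or $1\pmod 4$, and $(a,b,c)\notin\{(4,4,4),(4,4,5)\}$. Let $c'=c$ if $a+b+c$ is even and $c'=c-1$ otherwise, $S=(a+b+c')/2$, and $x=2a-S$, $y=2b-S$, $z=2c'-S$ (these are even nonnegative integers). Define three lists of length $x+y+z$, each the concatenation of a block of length $x$, a block of length $y$ and a block of length $z$ (a block of length $0$ is empty): First list: block 1 is $1,2,\dots,x$; block 2 is $x+1,x+1,x+2,x+2,\dots,x+y/2,x+y/2$ (each value twice); block 3 is $x+y/2+1,x+y/2+1,\dots,a,a$ (each value twice). Second list: block 1 is $1,1,2,2,\dots,x/2,x/2$; block 2 is $x/2+1,x/2+2,\dots,x/2+y$ (each once); block 3 is $x/2+y+1$, followed by each of $x/2+y+2,\dots,b$ twice in increasing order, followed by $x/2+y+1$. Third list: block 1 is $1$, followed by each of $2,\dots,x/2$ twice in increasing order, followed by $1$; block 2 is $x/2+1$, followed by each of $x/2+2,\dots,x/2+y/2$ twice in increasing order, followed by $x/2+1$; block 3 is $x/2+y/2+1,x/2+y/2+2,\dots,c'$ (each once). For $k\in[x+y+z]$ let $q_k$ be the triple whose entries are the $k$-th entries of the first, second and third list. Then $Q=\{q_1,\dots,q_{x+y+z}\}$ is a feasible strategy for $(a,b,c)$-Mastermind.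
   Context: $[n]=\{1,\dots,n\}$. In $(a,b,c)$-Mastermind, secrets and questions are triples in $[a]\times[b]\times[c]$. $g(s,q)$ is the number of $k\in[3]$ with $s_k=q_k$. A strategy is a set $Q$ of questions; it is feasible if for all distinct secrets $s,s'$ there is $q\in Q$ with $g(s,q)\neq g(s',q)$. -}

module Defs where

open import Data.Nat using (ℕ; zero; suc; _+_; _*_; _∸_; _≤_; _≡ᵇ_)
open import Data.Nat.DivMod using (_/_; _%_)
open import Data.Bool using (if_then_else_)
open import Data.List using (List; []; _∷_; _++_; concatMap; map; length)
open import Data.List.Membership.Propositional using (_∈_)
open import Data.List.Relation.Unary.All using (All)
open import Data.Product using (_×_; _,_; ∃-syntax)
open import Relation.Binary.PropositionalEquality using (_≡_; _≢_)

Triple : Set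
Triple = ℕ × ℕ × ℕ

InBox : ℕ → ℕ → ℕ → Triple → Set
InBox a b c (s₁ , s₂ , s₃) = (1 ≤ s₁ × s₁ ≤ a) × (1 ≤ s₂ × s₂ ≤ b) × (1 ≤ s₃ × s₃ ≤ c)

eqInd : ℕ → ℕ → ℕ
eqInd m n = if m ≡ᵇ n then 1 else 0

g : Triple → Triple → ℕ
g (s₁ , s₂ , s₃) (q₁ , q₂ , q₃) = eqInd s₁ q₁ + eqInd s₂ q₂ + eqInd s₃ q₃

IsStrategy : ℕ → ℕ → ℕ → List Triple → Set
IsStrategy a b c Q = All (InBox a b c) Q

Feasible : ℕ → ℕ → ℕ → List Triple → Set
Feasible a b c Q =
  ∀ s s' → InBox a b c s → InBox a b c s' → s ≢ s' →
  ∃[ q ] (q ∈ Q × g s q ≢ g s' q)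

seqFrom : ℕ → ℕ → List ℕ
seqFrom v zero    = []
seqFrom v (suc n) = v ∷ seqFrom (suc v) n

twice : List ℕ → List ℕ
twice = concatMap (λ v → v ∷ v ∷ [])

wrapped : ℕ → ℕ → ℕ → List ℕ
wrapped zero    v hi = []
wrapped (suc _) v hi = v ∷ (twice (seqFrom (suc v) (hi ∸ v)) ++ (v ∷ []))

module Construction (a b c : ℕ) where
  c' : ℕ
  c' = if (a + b + c) % 2 ≡ᵇ 0 then c else c ∸ 1

  S : ℕ
  S = (a + b + c') / 2

  x y z : ℕ
  x = 2 * a ∸ S
  y = 2 * b ∸ S
  z = 2 * c' ∸ S

  list₁ : List ℕ
  list₁ = seqFrom 1 x
       ++ twice (seqFrom (x + 1) (y / 2))
       ++ twice (seqFrom (x + y / 2 + 1) (a ∸ (x + y / 2)))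

  list₂ : List ℕ
  list₂ = twice (seqFrom 1 (x / 2))
       ++ seqFrom (x / 2 + 1) y
       ++ wrapped z (x / 2 + y + 1) b

  list₃ : List ℕ
  list₃ = wrapped x 1 (x / 2)
       ++ wrapped y (x / 2 + 1) (x / 2 + y / 2)
       ++ seqFrom (x / 2 + y / 2 + 1) (c' ∸ (x / 2 + y / 2))

  -- k-th entry (0-based index here), default 0
  entry : List ℕ → ℕ → ℕ
  entry []       _       = 0
  entry (v ∷ vs) zero    = v
  entry (v ∷ vs) (suc k) = entry vs k

  q : ℕ → Triple
  q k = entry list₁ (k ∸ 1) , entry list₂ (k ∸ 1) , entry list₃ (k ∸ 1)

  Q : List Triple
  Q = map q (seqFrom 1 (x + y + z))

{-# OPTIONS --safe #-}
module Submission where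

-- Write a = 2X+Y+Z, b = X+2Y+Z and c' = X+Y+2Z.  The questions come in three blocks of 2X, 2Y and 2Z
-- questions, and the values of each coordinate split into three consecutive windows, one per block.
-- At question t of a block of 2N questions, one coordinate is asked for value t of its window, another
-- for value ⌊t/2⌋ and the third for value cyclicHalf N t, so a block sees a secret only through those of
-- its coordinates that lie in the block's windows.  Summing the answers over a block counts each such
-- coordinate once if it is asked for value t and twice otherwise; an exhaustive check over the possible
-- placements of the three coordinates shows that these sums determine the placement, unless in every
-- block one secret is seen only through ⌊t/2⌋ and the other only through cyclicHalf N t.  For N ≥ 2
-- the pairings t ↦ ⌊t/2⌋ and t ↦ cyclicHalf N t have no class in common, so that exception forces
-- X = Y = Z = 1, i.e. (a, b, c) ∈ {(4,4,4), (4,4,5)}.  Once the placement is known, the answers in each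
-- block pin down the offsets of the coordinates within their windows, hence the secret.

open import Defs
open import Algebra.Properties.CommutativeSemigroup using (interchange)
open import Data.Bool using (Bool; true; false; if_then_else_)
import Data.Bool.Properties as Bool
open import Data.List using (List; []; _∷_; _++_; length; map; cartesianProduct)
open import Data.List.Properties using (length-++)
open import Data.List.Membership.Propositional using (_∈_; find)
open import Data.List.Membership.Propositional.Properties using (∈-cartesianProduct⁺; ∈-map⁺)
open import Data.List.Relation.Unary.All as All using (All; []; _∷_)
open import Data.List.Relation.Unary.All.Properties using (map⁺; ¬All⇒Any¬)
open import Data.List.Relation.Unary.Any using (here; there)
open import Data.Maybe using (Maybe; just; nothing; is-just)
import Data.Maybe.Properties as Maybe
open import Data.Maybe.Relation.Unary.All using (just; nothing; drop-just) renaming (All to AllM)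
open import Data.Nat
open import Data.Nat.DivMod using (_/_; _%_; m≡m%n+[m/n]*n; [m+kn]%n≡m%n; m*n%n≡0; m*n/n≡m)
open import Data.Nat.Properties
open import Data.Nat.Solver using (module +-*-Solver)
open import Data.Product using (_×_; _,_; proj₁; proj₂; Σ-syntax; uncurry)
open import Data.Product.Properties using (≡-dec)
open import Data.Sum using (_⊎_; inj₁; inj₂; [_,_])
open import Function using (_∘_; id; flip)
open import Relation.Binary.Definitions using (DecidableEquality)
open import Relation.Binary.PropositionalEquality hiding ([_])
open import Relation.Nullary using (¬_; Dec; yes; no; does; contradiction)
open import Relation.Nullary.Decidable using (_×-dec_; _⊎-dec_; _→-dec_; from-yes)

double : ℕ → ℕ
double zero    = 0
double (suc n) = suc (suc (double n))

⌊double/2⌋ : ∀ q → ⌊ double q /2⌋ ≡ q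
⌊double/2⌋ zero    = refl
⌊double/2⌋ (suc q) = cong suc (⌊double/2⌋ q)

⌊1+double/2⌋ : ∀ q → ⌊ suc (double q) /2⌋ ≡ q
⌊1+double/2⌋ zero    = refl
⌊1+double/2⌋ (suc q) = cong suc (⌊1+double/2⌋ q)

double-injective : ∀ {p q} → double p ≡ double q → p ≡ q
double-injective {zero}  {zero}  _  = refl
double-injective {suc p} {suc q} eq = cong suc (double-injective (suc-injective (suc-injective eq)))

double≢1+double : ∀ p q → double p ≢ suc (double q)
double≢1+double (suc p) (suc q) = double≢1+double p q ∘ suc-injective ∘ suc-injective

double≡*2 : ∀ n → double n ≡ n * 2
double≡*2 zero    = refl
double≡*2 (suc n) = cong (suc ∘ suc) (double≡*2 n)

double/2 : ∀ n → double n / 2 ≡ n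
double/2 n = trans (cong (_/ 2) (double≡*2 n)) (m*n/n≡m n 2)

even-or-odd : ∀ t → t ≡ double ⌊ t /2⌋ ⊎ t ≡ suc (double ⌊ t /2⌋)
even-or-odd zero          = inj₁ refl
even-or-odd (suc zero)    = inj₂ refl
even-or-odd (suc (suc t)) with even-or-odd t
... | inj₁ even = inj₁ (cong (suc ∘ suc) even)
... | inj₂ odd  = inj₂ (cong (suc ∘ suc) odd)

1+double-mono-< : ∀ {j N} → j < N → suc (double j) < double N
1+double-mono-< {zero}  {suc N} _         = s≤s (s≤s z≤n)
1+double-mono-< {suc j} {suc N} (s≤s j<N) = s≤s (s≤s (1+double-mono-< j<N))

double-mono-< : ∀ {j N} → j < N → double j < double N
double-mono-< = <⇒≤ ∘ 1+double-mono-<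

⌊/2⌋-< : ∀ {t N} → t < double N → ⌊ t /2⌋ < N
⌊/2⌋-< {zero}        {suc N} _                = s≤s z≤n
⌊/2⌋-< {suc zero}    {suc N} _                = s≤s z≤n
⌊/2⌋-< {suc (suc t)} {suc N} (s≤s (s≤s t<2N)) = s≤s (⌊/2⌋-< t<2N)

1+[m+n]≡m+1+n : ∀ m n → suc (m + n) ≡ m + 1 + n
1+[m+n]≡m+1+n m n = sym (trans (+-assoc m 1 n) (+-suc m n))

[m+1]+n≢0 : ∀ m n → m + 1 + n ≢ 0
[m+1]+n≢0 m n = m+1+n≢0 m ∘ m+n≡0⇒m≡0 (m + 1)

m+1+n≡1⇒n≡0 : ∀ m n → m + 1 + n ≡ 1 → n ≡ 0
m+1+n≡1⇒n≡0 m n eq = m+n≡0⇒n≡0 m (suc-injective (trans (sym (+-suc m n)) (trans (sym (+-assoc m 1 n)) eq)))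

x≤1∧x≡m+n+1⇒x≡1∧n≡0 : ∀ {x} m n → x ≤ 1 → x ≡ m + n + 1 → x ≡ 1 × n ≡ 0
x≤1∧x≡m+n+1⇒x≡1∧n≡0 m n z≤n       eq = contradiction (sym eq) ([m+1]+n≢0 (m + n) 0 ∘ trans (+-identityʳ _))
x≤1∧x≡m+n+1⇒x≡1∧n≡0 m n (s≤s z≤n) eq = refl , m+n≡0⇒n≡0 m (+-cancelʳ-≡ 1 (m + n) 0 (sym eq))

+-cancel-middle : ∀ a b c a' c' → a + b + c ≡ a' + b + c' → a + c ≡ a' + c'
+-cancel-middle a b c a' c' eq = +-cancelˡ-≡ b _ _ (trans (shuffle a c) (trans eq (sym (shuffle a' c'))))
  where
  shuffle : ∀ x y → b + (x + y) ≡ x + b + y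
  shuffle x y = trans (sym (+-assoc b x y)) (cong (_+ y) (+-comm b x))

∸-<-shift : ∀ {o v m} → o ≤ v → v < o + m → v ∸ o < m
∸-<-shift {o} {v} {m} o≤v v<o+m = +-cancelˡ-< o (v ∸ o) m (subst (_< o + m) (sym (m+[n∸m]≡n o≤v)) v<o+m)

∸-shift-≡ : ∀ {o v} → o ≤ v → o + 1 + (v ∸ o) ≡ suc v
∸-shift-≡ {o} {v} o≤v = trans (cong (_+ (v ∸ o)) (+-comm o 1)) (cong suc (m+[n∸m]≡n o≤v))

if-≡ᵇ-≡ : ∀ {A : Set} {m n} {x y : A} → m ≡ n → (if m ≡ᵇ n then x else y) ≡ x
if-≡ᵇ-≡ {m = m} refl with m ≡ᵇ m | ≡⇒≡ᵇ m m refl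
... | true | _ = refl

if-≡ᵇ-≢ : ∀ {A : Set} {m n} {x y : A} → m ≢ n → (if m ≡ᵇ n then x else y) ≡ y
if-≡ᵇ-≢ {m = m} {n} m≢n with m ≡ᵇ n | ≡ᵇ⇒≡ m n
... | false | _   = refl
... | true  | m≡n = contradiction (m≡n _) m≢n

eqInd-≡ : ∀ {m n} → m ≡ n → eqInd m n ≡ 1
eqInd-≡ = if-≡ᵇ-≡

eqInd-≢ : ∀ {m n} → m ≢ n → eqInd m n ≡ 0
eqInd-≢ = if-≡ᵇ-≢

eqInd≢0⇒≡ : ∀ {m n} → eqInd m n ≢ 0 → m ≡ n
eqInd≢0⇒≡ {m} {n} ≢0 with m ≟ n
... | yes m≡n = m≡n
... | no  m≢n = contradiction (eqInd-≢ m≢n) ≢0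

eqInd≡1⇒≡ : ∀ {m n} → eqInd m n ≡ 1 → m ≡ n
eqInd≡1⇒≡ ≡1 = eqInd≢0⇒≡ (λ ≡0 → 1+n≢0 (trans (sym ≡1) ≡0))

eqInd-hit : ∀ {j x} → x ≡ j → eqInd j x ≡ 1
eqInd-hit = eqInd-≡ ∘ sym

eqInd-miss : ∀ {j j' x} → x ≡ j → j ≢ j' → eqInd j' x ≡ 0
eqInd-miss x≡j j≢j' = eqInd-≢ (j≢j' ∘ trans (sym x≡j) ∘ sym)

eqInd≤1 : ∀ m n → eqInd m n ≤ 1
eqInd≤1 m n with m ≟ n
... | yes m≡n = ≤-reflexive (eqInd-≡ m≡n)
... | no  m≢n = ≤-trans (≤-reflexive (eqInd-≢ m≢n)) z≤n

eqInd-+ : ∀ o m n → eqInd (o + m) (o + n) ≡ eqInd m n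
eqInd-+ zero    m n = refl
eqInd-+ (suc o) m n = eqInd-+ o m n

indicator-injective : ∀ (f : ℕ → ℕ) {n j k t} → t < n → f t ≡ j →
  (∀ {t} → t < n → eqInd j (f t) ≡ eqInd k (f t)) → j ≡ k
indicator-injective f t<n ft≡j same =
  sym (trans (eqInd≡1⇒≡ (trans (sym (same t<n)) (eqInd-hit ft≡j))) ft≡j)

sumBelow : ℕ → (ℕ → ℕ) → ℕ
sumBelow zero    u = 0
sumBelow (suc n) u = sumBelow n u + u n

sumBelow-cong : ∀ n {u v} → (∀ {t} → t < n → u t ≡ v t) → sumBelow n u ≡ sumBelow n v
sumBelow-cong zero    u≗v = refl
sumBelow-cong (suc n) u≗v = cong₂ _+_ (sumBelow-cong n (u≗v ∘ m<n⇒m<1+n)) (u≗v ≤-refl)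

sumBelow-+ : ∀ n u v → sumBelow n (λ t → u t + v t) ≡ sumBelow n u + sumBelow n v
sumBelow-+ zero    u v = refl
sumBelow-+ (suc n) u v =
  trans (cong (_+ (u n + v n)) (sumBelow-+ n u v))
        (interchange +-commutativeSemigroup (sumBelow n u) (sumBelow n v) (u n) (v n))

sumBelow-0 : ∀ n → sumBelow n (λ _ → 0) ≡ 0
sumBelow-0 zero    = refl
sumBelow-0 (suc n) = cong (_+ 0) (sumBelow-0 n)

sumBelow-eqInd-≥ : ∀ {n i} → n ≤ i → sumBelow n (eqInd i) ≡ 0
sumBelow-eqInd-≥ {zero}  n≤i = refl
sumBelow-eqInd-≥ {suc n} n<i =
  cong₂ _+_ (sumBelow-eqInd-≥ (<⇒≤ n<i)) (eqInd-≢ (≢-sym (<⇒≢ n<i)))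

sumBelow-eqInd : ∀ {n i} → i < n → sumBelow n (eqInd i) ≡ 1
sumBelow-eqInd {suc n} {i} i<1+n with m≤n⇒m<n∨m≡n (s≤s⁻¹ i<1+n)
... | inj₁ i<n  = cong₂ _+_ (sumBelow-eqInd i<n) (eqInd-≢ (<⇒≢ i<n))
... | inj₂ refl = cong₂ _+_ (sumBelow-eqInd-≥ {n} ≤-refl) (eqInd-≡ {n} refl)

-- Pairings

record Pairing (n N : ℕ) (f : ℕ → ℕ) : Set where
  field
    fst snd    : ℕ → ℕ
    fst<n      : ∀ {j} → j < N → fst j < n
    snd<n      : ∀ {j} → j < N → snd j < n
    fst≢snd    : ∀ {j} → j < N → fst j ≢ snd j
    f-fst      : ∀ {j} → j < N → f (fst j) ≡ j
    f-snd      : ∀ {j} → j < N → f (snd j) ≡ j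
    fst-or-snd : ∀ {t} → t < n → t ≡ fst (f t) ⊎ t ≡ snd (f t)

  mate : ∀ {t} → t < n → f t < N → Σ[ s ∈ ℕ ] s < n × s ≢ t × f s ≡ f t
  mate {t} t<n ft<N with fst-or-snd t<n
  ... | inj₁ t≡fst = snd (f t) , snd<n ft<N , fst≢snd ft<N ∘ trans (sym t≡fst) ∘ sym , f-snd ft<N
  ... | inj₂ t≡snd = fst (f t) , fst<n ft<N , fst≢snd ft<N ∘ flip trans t≡snd , f-fst ft<N

  fst≡⇒ : ∀ {j t} → j < N → fst j ≡ t → j ≡ f t
  fst≡⇒ j<N refl = sym (f-fst j<N)

  snd≡⇒ : ∀ {j t} → j < N → snd j ≡ t → j ≡ f t
  snd≡⇒ j<N refl = sym (f-snd j<N)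

  eqInd-class : ∀ {j t} → j < N → t < n → eqInd j (f t) ≡ eqInd (fst j) t + eqInd (snd j) t
  eqInd-class {j} {t} j<N t<n with j ≟ f t
  ... | no j≢ft =
    trans (eqInd-≢ j≢ft) (sym (cong₂ _+_ (eqInd-≢ (j≢ft ∘ fst≡⇒ j<N)) (eqInd-≢ (j≢ft ∘ snd≡⇒ j<N))))
  ... | yes refl with fst-or-snd t<n
  ...   | inj₁ t≡fst = trans (eqInd-≡ {f t} refl)
          (sym (cong₂ _+_ (eqInd-hit t≡fst) (eqInd-≢ (fst≢snd j<N ∘ trans (sym t≡fst) ∘ sym))))
  ...   | inj₂ t≡snd = trans (eqInd-≡ {f t} refl)
          (sym (cong₂ _+_ (eqInd-≢ (fst≢snd j<N ∘ flip trans t≡snd)) (eqInd-hit t≡snd)))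

  class-sum : ∀ {j} → j < N → sumBelow n (λ t → eqInd j (f t)) ≡ 2
  class-sum {j} j<N = begin
    sumBelow n (λ t → eqInd j (f t))                        ≡⟨ sumBelow-cong n (eqInd-class j<N) ⟩
    sumBelow n (λ t → eqInd (fst j) t + eqInd (snd j) t)    ≡⟨ sumBelow-+ n (eqInd (fst j)) (eqInd (snd j)) ⟩
    sumBelow n (eqInd (fst j)) + sumBelow n (eqInd (snd j)) ≡⟨ cong₂ _+_ (sumBelow-eqInd (fst<n j<N))
                                                                          (sumBelow-eqInd (snd<n j<N)) ⟩
    2                                                       ∎
    where open ≡-Reasoning

  class-injective : ∀ {j j'} → j < N → (∀ {t} → t < n → eqInd j (f t) ≡ eqInd j' (f t)) → j ≡ j'
  class-injective j<N = indicator-injective f (fst<n j<N) (f-fst j<N)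

  point+class-injective : ∀ {i i' j j'} → i < n → j < N →
    (∀ {t} → t < n → eqInd i t + eqInd j (f t) ≡ eqInd i' t + eqInd j' (f t)) → i ≡ i' × j ≡ j'
  point+class-injective {i} {i'} {j} {j'} i<n j<N agree with j ≟ j'
  ... | yes refl =
    indicator-injective id i<n refl (λ {t} t<n → +-cancelʳ-≡ (eqInd j (f t)) _ _ (agree t<n)) , refl
  ... | no j≢j' =
    contradiction (trans (sym (hit (fst<n j<N) (f-fst j<N))) (hit (snd<n j<N) (f-snd j<N))) (fst≢snd j<N)
    where
    hit : ∀ {t} → t < n → f t ≡ j → i' ≡ t
    hit {t} t<n ft≡j = eqInd≢0⇒≡ λ i't≡0 → m+1+n≢0 (eqInd i t) (begin
      eqInd i t + 1               ≡⟨ cong (eqInd i t +_) (sym (eqInd-hit ft≡j)) ⟩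
      eqInd i t + eqInd j (f t)   ≡⟨ agree t<n ⟩
      eqInd i' t + eqInd j' (f t) ≡⟨ cong₂ _+_ i't≡0 (eqInd-miss ft≡j j≢j') ⟩
      0                           ∎)
      where open ≡-Reasoning

module Transversal {n N f h} (F : Pairing n N f) (H : Pairing n N h)
  (jointly-injective : ∀ {t t'} → t < n → t' < n → f t ≡ f t' → h t ≡ h t' → t ≡ t') where
  private
    module F = Pairing F
    module H = Pairing H

  crossing : ∀ {j} → j < N → h (F.fst j) ≢ h (F.snd j)
  crossing j<N =
    F.fst≢snd j<N ∘ jointly-injective (F.fst<n j<N) (F.snd<n j<N) (trans (F.f-fst j<N) (sym (F.f-snd j<N)))

  class-uncovered : ∀ {j k} → j < N → ¬ (∀ {t} → t < n → f t ≡ j → h t ≡ k)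
  class-uncovered j<N covered =
    crossing j<N (trans (covered (F.fst<n j<N) (F.f-fst j<N)) (sym (covered (F.snd<n j<N) (F.f-snd j<N))))

  class≢class : ∀ {j k} → j < N → ¬ (∀ {t} → t < n → eqInd j (f t) ≡ eqInd k (h t))
  class≢class {k = k} j<N agree =
    class-uncovered j<N (λ t<n ft≡j → sym (eqInd≡1⇒≡ {k} (trans (sym (agree t<n)) (eqInd-hit ft≡j))))

  class+class-distinct : ∀ {j j' k k'} → j < N → j ≢ j' →
    ¬ (∀ {t} → t < n → eqInd j (f t) + eqInd k (h t) ≡ eqInd j' (f t) + eqInd k' (h t))
  class+class-distinct {j} {j'} {k} {k'} j<N j≢j' agree = class-uncovered j<N covered
    where
    covered : ∀ {t} → t < n → f t ≡ j → h t ≡ k'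
    covered {t} t<n ft≡j = sym (eqInd≢0⇒≡ λ ≡0 → 1+n≢0 (begin
      1 + eqInd k (h t)                ≡⟨ cong (_+ eqInd k (h t)) (sym (eqInd-hit ft≡j)) ⟩
      eqInd j (f t) + eqInd k (h t)    ≡⟨ agree t<n ⟩
      eqInd j' (f t) + eqInd k' (h t)  ≡⟨ cong₂ _+_ (eqInd-miss ft≡j j≢j') ≡0 ⟩
      0                                ∎))
      where open ≡-Reasoning

  -- Each point of the f-class j is covered on the primed side by i' or by the h-class k'; as k' meets
  -- that class at most once, i' is one of its points a and k' contains the other one, b.  Comparing
  -- at b gives k ≢ k', and then at the h-mate s of b only the indicator of i can match, so i = s.
  private
    module Mismatch {i i' j j' k k'} (j<N : j < N) (k'<N : k' < N) (j≢j' : j ≢ j')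
      (agree : ∀ {t} → t < n →
               eqInd i t + eqInd j (f t) + eqInd k (h t) ≡ eqInd i' t + eqInd j' (f t) + eqInd k' (h t))
      where
      open ≡-Reasoning

      covered : ∀ {t} → t < n → f t ≡ j → i' ≡ t ⊎ k' ≡ h t
      covered {t} t<n ft≡j with i' ≟ t | k' ≟ h t
      ... | yes i'≡t | _         = inj₁ i'≡t
      ... | no _     | yes k'≡ht = inj₂ k'≡ht
      ... | no i'≢t  | no k'≢ht  = contradiction (begin
        eqInd i t + 1 + eqInd k (h t)                ≡⟨ cong (λ x → eqInd i t + x + eqInd k (h t)) (sym (eqInd-hit ft≡j)) ⟩
        eqInd i t + eqInd j (f t) + eqInd k (h t)    ≡⟨ agree t<n ⟩
        eqInd i' t + eqInd j' (f t) + eqInd k' (h t) ≡⟨ cong₂ _+_ (cong₂ _+_ (eqInd-≢ i'≢t) (eqInd-miss ft≡j j≢j'))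
                                                                 (eqInd-≢ k'≢ht) ⟩
        0                                            ∎) ([m+1]+n≢0 (eqInd i t) (eqInd k (h t)))

      settle : ∀ {a b} → a ≢ b → f a ≡ j → b < n → f b ≡ j → i' ≡ a → k' ≡ h b → f i' ≡ j × f i ≢ j'
      settle {a} {b} a≢b fa≡j b<n fb≡j refl refl with H.mate b<n k'<N
      ... | s , s<n , s≢b , hs≡hb = fa≡j , fi≢j'
        where
        k-miss : eqInd k (h b) ≡ 0
        k-miss = m+1+n≡1⇒n≡0 (eqInd i b) (eqInd k (h b)) (begin
          eqInd i b + 1 + eqInd k (h b)                  ≡⟨ cong (λ x → eqInd i b + x + eqInd k (h b))
                                                                  (sym (eqInd-hit fb≡j)) ⟩
          eqInd i b + eqInd j (f b) + eqInd k (h b)      ≡⟨ agree b<n ⟩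
          eqInd a b + eqInd j' (f b) + eqInd (h b) (h b) ≡⟨ cong₂ _+_ (cong₂ _+_ (eqInd-≢ a≢b) (eqInd-miss fb≡j j≢j'))
                                                                     (eqInd-≡ {h b} refl) ⟩
          1                                              ∎)
        j-miss : eqInd j (f s) ≡ 0
        j-miss = eqInd-≢ (λ j≡fs → s≢b (jointly-injective s<n b<n (trans (sym j≡fs) (sym fb≡j)) hs≡hb))
        i-hit×j'-miss : eqInd i s ≡ 1 × eqInd j' (f s) ≡ 0
        i-hit×j'-miss = x≤1∧x≡m+n+1⇒x≡1∧n≡0 (eqInd a s) (eqInd j' (f s)) (eqInd≤1 i s) (begin
          eqInd i s                                      ≡⟨ sym (trans (+-identityʳ _) (+-identityʳ _)) ⟩
          eqInd i s + 0 + 0                              ≡⟨ cong₂ (λ x y → eqInd i s + x + y) (sym j-miss)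
                                                                  (sym (trans (cong (eqInd k) hs≡hb) k-miss)) ⟩
          eqInd i s + eqInd j (f s) + eqInd k (h s)      ≡⟨ agree s<n ⟩
          eqInd a s + eqInd j' (f s) + eqInd (h b) (h s) ≡⟨ cong (eqInd a s + eqInd j' (f s) +_) (eqInd-hit hs≡hb) ⟩
          eqInd a s + eqInd j' (f s) + 1                 ∎)
        fi≢j' : f i ≢ j'
        fi≢j' fi≡j' = 1+n≢0 (trans (sym (eqInd-hit fs≡j')) (proj₂ i-hit×j'-miss))
          where
          fs≡j' : f s ≡ j'
          fs≡j' = trans (cong f (sym (eqInd≡1⇒≡ (proj₁ i-hit×j'-miss)))) fi≡j'

      located : f i' ≡ j × f i ≢ j'
      located with covered (F.fst<n j<N) (F.f-fst j<N) | covered (F.snd<n j<N) (F.f-snd j<N)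
      ... | inj₁ e₀ | inj₁ e₁ = contradiction (trans (sym e₀) e₁) (F.fst≢snd j<N)
      ... | inj₂ e₀ | inj₂ e₁ = contradiction (trans (sym e₀) e₁) (crossing j<N)
      ... | inj₁ e₀ | inj₂ e₁ = settle (F.fst≢snd j<N) (F.f-fst j<N) (F.snd<n j<N) (F.f-snd j<N) e₀ e₁
      ... | inj₂ e₀ | inj₁ e₁ = settle (F.fst≢snd j<N ∘ sym) (F.f-snd j<N) (F.fst<n j<N) (F.f-fst j<N) e₁ e₀

  point+class+class-distinct : ∀ {i i' j j' k k'} → j < N → j' < N → k < N → k' < N → j ≢ j' →
    ¬ (∀ {t} → t < n → eqInd i t + eqInd j (f t) + eqInd k (h t) ≡ eqInd i' t + eqInd j' (f t) + eqInd k' (h t))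
  point+class+class-distinct {i} {i'} {j} {j'} {k} {k'} j<N j'<N k<N k'<N j≢j' agree =
    proj₂ (Mismatch.located {i} {i'} {j} {j'} {k} {k'} j<N k'<N j≢j' agree)
          (proj₁ (Mismatch.located {i'} {i} {j'} {j} {k'} {k} j'<N k<N (j≢j' ∘ sym) (λ t<n → sym (agree t<n))))

halving : ∀ N → Pairing (double N) N ⌊_/2⌋
halving N = record
  { fst        = double
  ; snd        = suc ∘ double
  ; fst<n      = double-mono-<
  ; snd<n      = 1+double-mono-<
  ; fst≢snd    = λ {j} _ → double≢1+double j j
  ; f-fst      = λ {j} _ → ⌊double/2⌋ j
  ; f-snd      = λ {j} _ → ⌊1+double/2⌋ j
  ; fst-or-snd = λ {t} _ → even-or-odd t
  }

-- ⌈ t /2⌉ modulo N for t < 2N: the pattern of a `wrapped` block, pairing 2k-1 with 2k and 2N-1 with 0.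
cyclicHalf : ℕ → ℕ → ℕ
cyclicHalf N t = if t ≡ᵇ pred (double N) then 0 else ⌈ t /2⌉

cyclicHalf-double : ∀ K q → cyclicHalf (suc K) (double q) ≡ q
cyclicHalf-double K q = trans (if-≡ᵇ-≢ (double≢1+double q K)) (⌊1+double/2⌋ q)

cyclicHalf-1+double : ∀ {K q} → q ≢ K → cyclicHalf (suc K) (suc (double q)) ≡ suc q
cyclicHalf-1+double {K} {q} q≢K =
  trans (if-≡ᵇ-≢ (q≢K ∘ double-injective ∘ suc-injective)) (cong suc (⌊double/2⌋ q))

cyclicHalf-last : ∀ K → cyclicHalf (suc K) (suc (double K)) ≡ 0
cyclicHalf-last K = if-≡ᵇ-≡ {m = double K} refl

cyclicHalf-< : ∀ {N t} → t < double N → cyclicHalf N t < N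
cyclicHalf-< {suc K} {t} t<2N with t ≟ suc (double K)
... | yes t≡last = subst (_< suc K) (sym (if-≡ᵇ-≡ t≡last)) (s≤s z≤n)
... | no  t≢last = subst (_< suc K) (sym (if-≡ᵇ-≢ t≢last)) (⌊/2⌋-< (s≤s (≤∧≢⇒< (s≤s⁻¹ t<2N) t≢last)))

cyclicHalving : ∀ N → Pairing (double N) N (cyclicHalf N)
cyclicHalving zero = record
  { fst = id ; snd = id ; fst<n = λ () ; snd<n = λ () ; fst≢snd = λ ()
  ; f-fst = λ () ; f-snd = λ () ; fst-or-snd = λ () }
cyclicHalving (suc K) = record
  { fst = fst ; snd = snd ; fst<n = fst<n ; snd<n = snd<n ; fst≢snd = fst≢snd
  ; f-fst = f-fst ; f-snd = f-snd ; fst-or-snd = fst-or-snd }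
  where
  fst snd : ℕ → ℕ
  fst zero    = 0
  fst (suc k) = suc (double k)
  snd zero    = suc (double K)
  snd (suc k) = double (suc k)

  fst<n : ∀ {j} → j < suc K → fst j < double (suc K)
  fst<n {zero}  _  = s≤s z≤n
  fst<n {suc k} lt = 1+double-mono-< (m<n⇒m<1+n (s≤s⁻¹ lt))

  snd<n : ∀ {j} → j < suc K → snd j < double (suc K)
  snd<n {zero}  _  = ≤-refl
  snd<n {suc k} lt = double-mono-< lt

  fst≢snd : ∀ {j} → j < suc K → fst j ≢ snd j
  fst≢snd {zero}  _ ()
  fst≢snd {suc k} _ = 1+n≢n ∘ sym

  f-fst : ∀ {j} → j < suc K → cyclicHalf (suc K) (fst j) ≡ j
  f-fst {zero}  _  = refl
  f-fst {suc k} lt = cyclicHalf-1+double (<⇒≢ (s≤s⁻¹ lt))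

  f-snd : ∀ {j} → j < suc K → cyclicHalf (suc K) (snd j) ≡ j
  f-snd {zero}  _ = cyclicHalf-last K
  f-snd {suc k} _ = cyclicHalf-double K (suc k)

  Covered : ℕ → Set
  Covered t = t ≡ fst (cyclicHalf (suc K) t) ⊎ t ≡ snd (cyclicHalf (suc K) t)

  even-covered : ∀ q → Covered (double q)
  even-covered q rewrite cyclicHalf-double K q with q
  ... | zero  = inj₁ refl
  ... | suc k = inj₂ refl

  odd-covered : ∀ q → Covered (suc (double q))
  odd-covered q with q ≟ K
  ... | yes refl = inj₂ (cong snd (sym (cyclicHalf-last K)))
  ... | no q≢K   = inj₁ (cong fst (sym (cyclicHalf-1+double q≢K)))

  fst-or-snd : ∀ {t} → t < double (suc K) → Covered t
  fst-or-snd {t} _ with even-or-odd t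
  ... | inj₁ even = subst Covered (sym even) (even-covered ⌊ t /2⌋)
  ... | inj₂ odd  = subst Covered (sym odd) (odd-covered ⌊ t /2⌋)

cyclicHalf-neighbours : ∀ {K q} → 1 ≤ K → cyclicHalf (suc K) (double q) ≢ cyclicHalf (suc K) (suc (double q))
cyclicHalf-neighbours {K} {q} 1≤K with q ≟ K
... | yes refl = λ eq → <⇒≢ 1≤K (sym (trans (sym (cyclicHalf-double K K)) (trans eq (cyclicHalf-last K))))
... | no q≢K   = λ eq → 1+n≢n (sym (trans (sym (cyclicHalf-double K q)) (trans eq (cyclicHalf-1+double q≢K))))

halves-jointly-injective : ∀ {N t t'} → 2 ≤ N → t < double N → t' < double N →
  ⌊ t /2⌋ ≡ ⌊ t' /2⌋ → cyclicHalf N t ≡ cyclicHalf N t' → t ≡ t'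
halves-jointly-injective {suc K} {t} {t'} (s≤s 1≤K) _ _ same-half same-cyclic with even-or-odd t | even-or-odd t'
... | inj₁ e | inj₁ e' = trans e (trans (cong double same-half) (sym e'))
... | inj₂ o | inj₂ o' = trans o (trans (cong (suc ∘ double) same-half) (sym o'))
... | inj₁ e | inj₂ o' = contradiction
      (trans (cong (cyclicHalf (suc K)) (sym e)) (trans same-cyclic
        (trans (cong (cyclicHalf (suc K)) o') (cong (cyclicHalf (suc K) ∘ suc ∘ double) (sym same-half)))))
      (cyclicHalf-neighbours 1≤K)
... | inj₂ o | inj₁ e' = contradiction
      (trans (cong (cyclicHalf (suc K)) (sym e')) (trans (sym same-cyclic)
        (trans (cong (cyclicHalf (suc K)) o) (cong (cyclicHalf (suc K) ∘ suc ∘ double) same-half))))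
      (cyclicHalf-neighbours 1≤K)

module Halves {N} (2≤N : 2 ≤ N) = Transversal (halving N) (cyclicHalving N) (halves-jointly-injective 2≤N)

distinct-below⇒2≤ : ∀ {j j' N} → j < N → j' < N → j ≢ j' → 2 ≤ N
distinct-below⇒2≤ {zero}  {zero}  _             _             j≢j' = contradiction refl j≢j'
distinct-below⇒2≤ {suc _}         (s≤s (s≤s _)) _             _    = s≤s (s≤s z≤n)
distinct-below⇒2≤ {zero}  {suc _} _             (s≤s (s≤s _)) _    = s≤s (s≤s z≤n)

-- Blocks seen from one secret

-- The offsets, within the windows of a block, of the coordinates asked at question t for value t,
-- ⌊ t /2⌋ and cyclicHalf N t respectively; nothing if that coordinate lies outside its window.
Local : Set
Local = Maybe ℕ × Maybe ℕ × Maybe ℕ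

hits : Maybe ℕ → ℕ → ℕ
hits nothing  _ = 0
hits (just i) t = eqInd i t

score : ℕ → Local → ℕ → ℕ
score N (mi , mj , mk) t = hits mi t + hits mj ⌊ t /2⌋ + hits mk (cyclicHalf N t)

_≈[_]_ : Local → ℕ → Local → Set
c ≈[ N ] c' = ∀ {t} → t < double N → score N c t ≡ score N c' t

Valid : ℕ → Local → Set
Valid N (mi , mj , mk) = AllM (_< double N) mi × AllM (_< N) mj × AllM (_< N) mk

Roles : Set
Roles = Bool × Bool × Bool

present : Local → Roles
present (mi , mj , mk) = is-just mi , is-just mj , is-just mk

weight : Roles → ℕ
weight (i , j , k) = (if i then 1 else 0) + (if j then 2 else 0) + (if k then 2 else 0)

sumBelow-hits-point : ∀ {n m} → AllM (_< n) m → sumBelow n (hits m) ≡ (if is-just m then 1 else 0)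
sumBelow-hits-point {n} nothing    = sumBelow-0 n
sumBelow-hits-point     (just i<n) = sumBelow-eqInd i<n

sumBelow-hits-class : ∀ {n N f m} → Pairing n N f → AllM (_< N) m →
  sumBelow n (λ t → hits m (f t)) ≡ (if is-just m then 2 else 0)
sumBelow-hits-class {n} F nothing    = sumBelow-0 n
sumBelow-hits-class     F (just j<N) = Pairing.class-sum F j<N

sumBelow-score : ∀ {N c} → Valid N c → sumBelow (double N) (score N c) ≡ weight (present c)
sumBelow-score {N} {mi , mj , mk} (vi , vj , vk) = begin
  sumBelow n (score N (mi , mj , mk))
    ≡⟨ sumBelow-+ n (λ t → hits mi t + hits mj ⌊ t /2⌋) (λ t → hits mk (cyclicHalf N t)) ⟩
  sumBelow n (λ t → hits mi t + hits mj ⌊ t /2⌋) + sumBelow n (λ t → hits mk (cyclicHalf N t))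
    ≡⟨ cong (_+ _) (sumBelow-+ n (hits mi) (λ t → hits mj ⌊ t /2⌋)) ⟩
  sumBelow n (hits mi) + sumBelow n (λ t → hits mj ⌊ t /2⌋) + sumBelow n (λ t → hits mk (cyclicHalf N t))
    ≡⟨ cong₂ _+_ (cong₂ _+_ (sumBelow-hits-point vi) (sumBelow-hits-class (halving N) vj))
                 (sumBelow-hits-class (cyclicHalving N) vk) ⟩
  weight (present (mi , mj , mk)) ∎
  where
  open ≡-Reasoning
  n = double N

≈⇒same-weight : ∀ {N c c'} → Valid N c → Valid N c' → c ≈[ N ] c' → weight (present c) ≡ weight (present c')
≈⇒same-weight {N} vc vc' agree =
  trans (sym (sumBelow-score vc)) (trans (sumBelow-cong (double N) agree) (sumBelow-score vc'))

halving-only cyclic-only : Roles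
halving-only = false , true , false
cyclic-only = false , false , true

Swapped : Roles → Roles → Set
Swapped r r' = (r ≡ halving-only × r' ≡ cyclic-only) ⊎ (r ≡ cyclic-only × r' ≡ halving-only)

present≡halving-only : ∀ {c} → present c ≡ halving-only → Σ[ j ∈ ℕ ] c ≡ (nothing , just j , nothing)
present≡halving-only {nothing , just j , nothing} _ = j , refl
present≡halving-only {just _ , _ , _}             ()
present≡halving-only {nothing , nothing , _}      ()
present≡halving-only {nothing , just _ , just _}  ()

present≡cyclic-only : ∀ {c} → present c ≡ cyclic-only → Σ[ k ∈ ℕ ] c ≡ (nothing , nothing , just k)
present≡cyclic-only {nothing , nothing , just k}  _ = k , refl
present≡cyclic-only {just _ , _ , _}              ()
present≡cyclic-only {nothing , just _ , _}        ()
present≡cyclic-only {nothing , nothing , nothing} ()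

halving≈cyclic⇒N≡1 : ∀ {N j k} → j < N → (nothing , just j , nothing) ≈[ N ] (nothing , nothing , just k) → N ≡ 1
halving≈cyclic⇒N≡1 {suc zero}    _   _     = refl
halving≈cyclic⇒N≡1 {suc (suc M)} {j} {k} j<N agree = contradiction
  (λ {t} t<n → trans (sym (+-identityʳ _)) (agree {t} t<n)) (Halves.class≢class (s≤s (s≤s z≤n)) {j} {k} j<N)

swapped⇒N≡1 : ∀ {N c c'} → Valid N c → Valid N c' → c ≈[ N ] c' → Swapped (present c) (present c') → N ≡ 1
swapped⇒N≡1 {c = c} {c'} vc vc' agree (inj₁ (c-h , c'-c))
  with present≡halving-only {c} c-h | present≡cyclic-only {c'} c'-c
... | j , refl | k , refl = halving≈cyclic⇒N≡1 {k = k} (drop-just (proj₁ (proj₂ vc))) (λ {t} → agree {t})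
swapped⇒N≡1 {c = c} {c'} vc vc' agree (inj₂ (c-c , c'-h))
  with present≡cyclic-only {c} c-c | present≡halving-only {c'} c'-h
... | k , refl | j , refl = halving≈cyclic⇒N≡1 {k = k} (drop-just (proj₁ (proj₂ vc'))) (λ {t} t<n → sym (agree {t} t<n))

halving+cyclic-injective : ∀ {N j j' k k'} → j < N → j' < N → k < N →
  (nothing , just j , just k) ≈[ N ] (nothing , just j' , just k') → j ≡ j' × k ≡ k'
halving+cyclic-injective {N} {j} {j'} {k} {k'} j<N j'<N k<N agree with j ≟ j'
... | yes refl = refl , Pairing.class-injective (cyclicHalving N) k<N
                           (λ {t} t<n → +-cancelˡ-≡ (eqInd j ⌊ t /2⌋) _ _ (agree t<n))
... | no j≢j'  = contradiction (λ {t} → agree {t})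
  (Halves.class+class-distinct (distinct-below⇒2≤ j<N j'<N j≢j') {k = k} {k'} j<N j≢j')

point+halving+cyclic-injective : ∀ {N i i' j j' k k'} → i < double N → j < N → j' < N → k < N → k' < N →
  (just i , just j , just k) ≈[ N ] (just i' , just j' , just k') → i ≡ i' × j ≡ j' × k ≡ k'
point+halving+cyclic-injective {N} {i} {i'} {j} {j'} {k} {k'} i<n j<N j'<N k<N k'<N agree with j ≟ j'
... | yes refl =
  let i≡i' , k≡k' = Pairing.point+class-injective (cyclicHalving N) i<n k<N
                      (λ {t} t<n → +-cancel-middle (eqInd i t) (eqInd j ⌊ t /2⌋) _ (eqInd i' t) _ (agree t<n))
  in i≡i' , refl , k≡k'
... | no j≢j'  = contradiction (λ {t} → agree {t})
  (Halves.point+class+class-distinct (distinct-below⇒2≤ j<N j'<N j≢j') {i} {i'} {j} {j'} {k} {k'}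
                                     j<N j'<N k<N k'<N j≢j')

data Aligned : Maybe ℕ → Maybe ℕ → Set where
  neither : Aligned nothing nothing
  both    : ∀ i i' → Aligned (just i) (just i')

align : ∀ m m' → is-just m ≡ is-just m' → Aligned m m'
align nothing  nothing   _  = neither
align (just i) (just i') _  = both i i'
align nothing  (just _)  ()
align (just _) nothing   ()

same-presence⇒≡ : ∀ {N c c'} → Valid N c → Valid N c' → c ≈[ N ] c' → present c ≡ present c' → c ≡ c'
same-presence⇒≡ {N} {mi , mj , mk} {mi' , mj' , mk'} (vi , vj , vk) (_ , vj' , vk') agree same
  with align mi mi' (cong proj₁ same) | align mj mj' (cong (proj₁ ∘ proj₂) same)
     | align mk mk' (cong (proj₂ ∘ proj₂) same)
... | neither | neither | neither = refl
... | both i i' | neither | neither = cong (λ i → just i , nothing , nothing)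
  (indicator-injective id (drop-just vi) refl (λ t<n → +-cancelʳ-≡ 0 _ _ (+-cancelʳ-≡ 0 _ _ (agree t<n))))
... | neither | both j j' | neither = cong (λ j → nothing , just j , nothing)
  (Pairing.class-injective (halving N) (drop-just vj) (λ t<n → +-cancelʳ-≡ 0 _ _ (agree t<n)))
... | neither | neither | both k k' = cong (λ k → nothing , nothing , just k)
  (Pairing.class-injective (cyclicHalving N) (drop-just vk) agree)
... | both i i' | both j j' | neither = uncurry (cong₂ (λ i j → just i , just j , nothing))
  (Pairing.point+class-injective (halving N) (drop-just vi) (drop-just vj) (λ t<n → +-cancelʳ-≡ 0 _ _ (agree t<n)))
... | both i i' | neither | both k k' = uncurry (cong₂ (λ i k → just i , nothing , just k))
  (Pairing.point+class-injective (cyclicHalving N) (drop-just vi) (drop-just vk)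
    (λ {t} t<n → +-cancel-middle (eqInd i t) 0 _ (eqInd i' t) _ (agree t<n)))
... | neither | both j j' | both k k' = uncurry (cong₂ (λ j k → nothing , just j , just k))
  (halving+cyclic-injective (drop-just vj) (drop-just vj') (drop-just vk) agree)
... | both i i' | both j j' | both k k'
  with point+halving+cyclic-injective {N} {i} {i'} {j} {j'} {k} {k'}
         (drop-just vi) (drop-just vj) (drop-just vj') (drop-just vk) (drop-just vk') agree
...   | refl , refl , refl = refl

-- Placements

data Block : Set where
  block₁ block₂ block₃ : Block

_≟ᴮ_ : DecidableEquality Block
block₁ ≟ᴮ block₁ = yes refl
block₂ ≟ᴮ block₂ = yes refl
block₃ ≟ᴮ block₃ = yes refl
block₁ ≟ᴮ block₂ = no λ ()
block₁ ≟ᴮ block₃ = no λ ()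
block₂ ≟ᴮ block₁ = no λ ()
block₂ ≟ᴮ block₃ = no λ ()
block₃ ≟ᴮ block₁ = no λ ()
block₃ ≟ᴮ block₂ = no λ ()

-- The block whose window holds each coordinate; the third one may be c = c' + 1, which is never asked.
Placement : Set
Placement = Block × Block × Maybe Block

in? : Block → Maybe Block → Bool
in? B (just B') = does (B ≟ᴮ B')
in? B nothing   = false

rolesIn : Block → Placement → Roles
rolesIn block₁ (p₁ , p₂ , p₃) = in? block₁ (just p₁) , in? block₁ (just p₂) , in? block₁ p₃
rolesIn block₂ (p₁ , p₂ , p₃) = in? block₂ (just p₂) , in? block₂ (just p₁) , in? block₂ p₃
rolesIn block₃ (p₁ , p₂ , p₃) = in? block₃ p₃ , in? block₃ (just p₁) , in? block₃ (just p₂)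

∀-Block? : {P : Block → Set} → (∀ B → Dec (P B)) → Dec (∀ B → P B)
∀-Block? {P} P? with P? block₁ | P? block₂ | P? block₃
... | yes p₁ | yes p₂ | yes p₃ = yes λ { block₁ → p₁ ; block₂ → p₂ ; block₃ → p₃ }
... | no ¬p₁ | _      | _      = no λ all → ¬p₁ (all block₁)
... | yes _  | no ¬p₂ | _      = no λ all → ¬p₂ (all block₂)
... | yes _  | yes _  | no ¬p₃ = no λ all → ¬p₃ (all block₃)

blocks : List Block
blocks = block₁ ∷ block₂ ∷ block₃ ∷ []

∈-blocks : ∀ B → B ∈ blocks
∈-blocks block₁ = here refl
∈-blocks block₂ = there (here refl)
∈-blocks block₃ = there (there (here refl))

placements : List Placement
placements = cartesianProduct blocks (cartesianProduct blocks (nothing ∷ map just blocks))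

∈-placements : ∀ p → p ∈ placements
∈-placements (p₁ , p₂ , p₃) =
  ∈-cartesianProduct⁺ (∈-blocks p₁) (∈-cartesianProduct⁺ (∈-blocks p₂) (∈-maybe p₃))
  where
  ∈-maybe : ∀ m → m ∈ nothing ∷ map just blocks
  ∈-maybe nothing  = here refl
  ∈-maybe (just B) = there (∈-map⁺ just (∈-blocks B))

Determined : Placement → Placement → Set
Determined p p' = (∀ B → weight (rolesIn B p) ≡ weight (rolesIn B p')) →
                  p ≡ p' ⊎ (∀ B → Swapped (rolesIn B p) (rolesIn B p'))

determined? : ∀ p p' → Dec (Determined p p')
determined? p p' = ∀-Block? (λ B → weight (rolesIn B p) ≟ weight (rolesIn B p'))
  →-dec (≡-dec _≟ᴮ_ (≡-dec _≟ᴮ_ (Maybe.≡-dec _≟ᴮ_)) p p'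
         ⊎-dec ∀-Block? (λ B → swapped? (rolesIn B p) (rolesIn B p')))
  where
  _≟ᴿ_ : DecidableEquality Roles
  _≟ᴿ_ = ≡-dec Bool._≟_ (≡-dec Bool._≟_ Bool._≟_)
  swapped? : ∀ r r' → Dec (Swapped r r')
  swapped? r r' = (r ≟ᴿ halving-only ×-dec r' ≟ᴿ cyclic-only) ⊎-dec (r ≟ᴿ cyclic-only ×-dec r' ≟ᴿ halving-only)

-- Opaque, so that Agda never unfolds the table of all 36 × 36 cases where the lemma is used.
opaque
  placement-determined : ∀ p p' → Determined p p'
  placement-determined p p' = All.lookup (All.lookup table (∈-placements p)) (∈-placements p')
    where
    table : All (λ p → All (Determined p) placements) placements
    table = from-yes (All.all? (λ p → All.all? (determined? p) placements) placements)

-- Windows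

offset : (Block → ℕ) → Block → ℕ
offset w block₁ = 0
offset w block₂ = w block₁
offset w block₃ = w block₁ + w block₂

total : (Block → ℕ) → ℕ
total w = w block₁ + w block₂ + w block₃

data _≺_ : Block → Block → Set where
  1≺2 : block₁ ≺ block₂
  1≺3 : block₁ ≺ block₃
  2≺3 : block₂ ≺ block₃

≢⇒≺⊎≻ : ∀ {B B'} → B ≢ B' → B ≺ B' ⊎ B' ≺ B
≢⇒≺⊎≻ {block₁} {block₁} B≢B' = contradiction refl B≢B'
≢⇒≺⊎≻ {block₂} {block₂} B≢B' = contradiction refl B≢B'
≢⇒≺⊎≻ {block₃} {block₃} B≢B' = contradiction refl B≢B'
≢⇒≺⊎≻ {block₁} {block₂} _ = inj₁ 1≺2
≢⇒≺⊎≻ {block₁} {block₃} _ = inj₁ 1≺3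
≢⇒≺⊎≻ {block₂} {block₃} _ = inj₁ 2≺3
≢⇒≺⊎≻ {block₂} {block₁} _ = inj₂ 1≺2
≢⇒≺⊎≻ {block₃} {block₁} _ = inj₂ 1≺3
≢⇒≺⊎≻ {block₃} {block₂} _ = inj₂ 2≺3

offset-≺ : ∀ w {B B'} → B ≺ B' → offset w B + w B ≤ offset w B'
offset-≺ w 1≺2 = ≤-refl
offset-≺ w 1≺3 = m≤m+n (w block₁) (w block₂)
offset-≺ w 2≺3 = ≤-refl

window-≤-end : ∀ w {B v} → v < w B → offset w B + 1 + v ≤ offset w B + w B
window-≤-end w {B} {v} v<w = ≤-trans (≤-reflexive (+-assoc (offset w B) 1 v)) (+-monoʳ-≤ (offset w B) v<w)

end≤total : ∀ w B → offset w B + w B ≤ total w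
end≤total w block₁ = ≤-trans (m≤m+n (w block₁) (w block₂)) (m≤m+n (w block₁ + w block₂) (w block₃))
end≤total w block₂ = m≤m+n (w block₁ + w block₂) (w block₃)
end≤total w block₃ = ≤-refl

window-≺ : ∀ w {B B' v h} → B ≺ B' → v < w B → offset w B + 1 + v < offset w B' + 1 + h
window-≺ w {B} {B'} {v} {h} B≺B' v<w = begin-strict
  offset w B + 1 + v   ≤⟨ window-≤-end w v<w ⟩
  offset w B + w B     ≤⟨ offset-≺ w B≺B' ⟩
  offset w B'          <⟨ m<m+n (offset w B') z<s ⟩
  offset w B' + suc h  ≡⟨ sym (+-assoc (offset w B') 1 h) ⟩
  offset w B' + 1 + h  ∎
  where open ≤-Reasoning

windows-disjoint : ∀ w {B B' v h} → B ≢ B' → v < w B → h < w B' → offset w B + 1 + v ≢ offset w B' + 1 + h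
windows-disjoint w B≢B' v<w h<w with ≢⇒≺⊎≻ B≢B'
... | inj₁ B≺B' = <⇒≢ (window-≺ w B≺B' v<w)
... | inj₂ B'≺B = ≢-sym (<⇒≢ (window-≺ w B'≺B h<w))

in-window : ∀ w B {h n} → h < w B → total w ≤ n → 1 ≤ offset w B + 1 + h × offset w B + 1 + h ≤ n
in-window w B {h} h<w total≤n =
  subst (1 ≤_) (1+[m+n]≡m+1+n (offset w B) h) (s≤s z≤n) ,
  ≤-trans (≤-trans (window-≤-end w h<w) (end≤total w B)) total≤n

data Inside (w : Block → ℕ) : ℕ → Set where
  inside : ∀ B {v} → v < w B → Inside w (offset w B + 1 + v)

Located : (Block → ℕ) → ℕ → Set
Located w s = Inside w s ⊎ s ≡ suc (total w)

inside-split : ∀ {w s} → Inside w s → Σ[ B ∈ Block ] Σ[ v ∈ ℕ ] v < w B × s ≡ offset w B + 1 + v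
inside-split (inside B {v} v<w) = B , v , v<w , refl

blockOf : ∀ {w s} → Inside w s → Block
blockOf (inside B _) = B

blockOf⁺ : ∀ {w s} → Located w s → Maybe Block
blockOf⁺ (inj₁ l) = just (blockOf l)
blockOf⁺ (inj₂ _) = nothing

slot : ∀ {w s} → Block → Inside w s → Maybe ℕ
slot B (inside B' {v} _) with B ≟ᴮ B'
... | yes _ = just v
... | no _  = nothing

slot⁺ : ∀ {w s} → Block → Located w s → Maybe ℕ
slot⁺ B (inj₁ l) = slot B l
slot⁺ B (inj₂ _) = nothing

is-just-slot : ∀ {w s} B (l : Inside w s) → is-just (slot B l) ≡ in? B (just (blockOf l))
is-just-slot B (inside B' _) with B ≟ᴮ B'
... | yes _ = refl
... | no _  = refl

is-just-slot⁺ : ∀ {w s} B (l : Located w s) → is-just (slot⁺ B l) ≡ in? B (blockOf⁺ l)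
is-just-slot⁺ B (inj₁ l) = is-just-slot B l
is-just-slot⁺ B (inj₂ _) = refl

slot-valid : ∀ {w s} B (l : Inside w s) → AllM (_< w B) (slot B l)
slot-valid B (inside B' v<w) with B ≟ᴮ B'
... | yes refl = just v<w
... | no _     = nothing

slot⁺-valid : ∀ {w s} B (l : Located w s) → AllM (_< w B) (slot⁺ B l)
slot⁺-valid B (inj₁ l) = slot-valid B l
slot⁺-valid B (inj₂ _) = nothing

slot-eqInd : ∀ {w s} B (l : Inside w s) {h} → h < w B → eqInd s (offset w B + 1 + h) ≡ hits (slot B l) h
slot-eqInd {w} B (inside B' {v} v<w) {h} h<w with B ≟ᴮ B'
... | yes refl = eqInd-+ (offset w B + 1) v h
... | no B≢B'  = eqInd-≢ (windows-disjoint w (B≢B' ∘ sym) v<w h<w)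

slot⁺-eqInd : ∀ {w s} B (l : Located w s) {h} → h < w B → eqInd s (offset w B + 1 + h) ≡ hits (slot⁺ B l) h
slot⁺-eqInd B (inj₁ l)    h<w = slot-eqInd B l h<w
slot⁺-eqInd {w} B (inj₂ refl) h<w = eqInd-≢ (≢-sym (<⇒≢ (s≤s (≤-trans (window-≤-end w h<w) (end≤total w B)))))

slot-own : ∀ {w} B {v} (v<w : v < w B) → slot B (inside {w} B v<w) ≡ just v
slot-own {w} B v<w with B ≟ᴮ B
... | yes _   = refl
... | no B≢B = contradiction refl B≢B

slot≡just : ∀ {w : Block → ℕ} {B B' v v'} {v'<w : v' < w B'} → slot B (inside {w} B' v'<w) ≡ just v → B ≡ B' × v' ≡ v
slot≡just {B = B} {B'} eq with B ≟ᴮ B'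
slot≡just refl | yes B≡B' = B≡B' , refl

inside-injective : ∀ {w s s'} (l : Inside w s) (l' : Inside w s') → (∀ B → slot B l ≡ slot B l') → s ≡ s'
inside-injective {w} (inside B v<w) (inside B' v'<w) same with slot≡just {w} {v'<w = v'<w} (trans (sym (same B)) (slot-own {w} B v<w))
... | refl , refl = refl

located-injective : ∀ {w s s'} (l : Located w s) (l' : Located w s') → (∀ B → slot⁺ B l ≡ slot⁺ B l') → s ≡ s'
located-injective (inj₁ l)    (inj₁ l')    same = inside-injective l l' same
located-injective (inj₂ refl) (inj₂ refl)  _    = refl
located-injective {w} (inj₁ (inside B v<w)) (inj₂ _) same with trans (sym (slot-own {w} B v<w)) (same B)
... | ()
located-injective {w} (inj₂ _) (inj₁ (inside B v<w)) same with trans (sym (slot-own {w} B v<w)) (sym (same B))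
... | ()

locate : ∀ w {s} → 1 ≤ s → s ≤ total w → Inside w s
locate w {suc v} _ s≤total with v <? w block₁
... | yes v<w₁ = inside block₁ v<w₁
... | no v≮w₁ with v <? w block₁ + w block₂
...   | yes v<w₁₂ = subst (Inside w) (∸-shift-≡ (≮⇒≥ v≮w₁)) (inside block₂ (∸-<-shift (≮⇒≥ v≮w₁) v<w₁₂))
...   | no v≮w₁₂  =
  subst (Inside w) (∸-shift-≡ (≮⇒≥ v≮w₁₂)) (inside block₃ (∸-<-shift (≮⇒≥ v≮w₁₂) s≤total))

locate⁺ : ∀ w {s} → 1 ≤ s → s ≤ suc (total w) → Located w s
locate⁺ w 1≤s s≤ with m≤n⇒m<n∨m≡n s≤
... | inj₁ s< = inj₁ (locate w 1≤s (s≤s⁻¹ s<))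
... | inj₂ s≡ = inj₂ s≡

_‼_ : List ℕ → ℕ → ℕ
[]       ‼ _     = 0
(v ∷ vs) ‼ zero  = v
(v ∷ vs) ‼ suc k = vs ‼ k

‼-++ˡ : ∀ l l' {t} → t < length l → (l ++ l') ‼ t ≡ l ‼ t
‼-++ˡ (v ∷ l) l' {zero}  _         = refl
‼-++ˡ (v ∷ l) l' {suc t} (s≤s t<n) = ‼-++ˡ l l' t<n

‼-++ʳ : ∀ l l' t → (l ++ l') ‼ (length l + t) ≡ l' ‼ t
‼-++ʳ []      l' t = refl
‼-++ʳ (v ∷ l) l' t = ‼-++ʳ l l' t

concat₃ : (Block → List ℕ) → List ℕ
concat₃ l = l block₁ ++ l block₂ ++ l block₃

‼-concat₃ : ∀ (l : Block → List ℕ) {n : Block → ℕ} → (∀ B → length (l B) ≡ n B) →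
  ∀ B {t} → t < n B → concat₃ l ‼ (offset n B + t) ≡ l B ‼ t
‼-concat₃ l len block₁ t<n = ‼-++ˡ (l block₁) _ (subst (_ <_) (sym (len block₁)) t<n)
‼-concat₃ l {n} len block₂ {t} t<n rewrite sym (len block₁) =
  trans (‼-++ʳ (l block₁) _ t) (‼-++ˡ (l block₂) _ (subst (_ <_) (sym (len block₂)) t<n))
‼-concat₃ l {n} len block₃ {t} t<n rewrite sym (len block₁) | sym (len block₂) =
  trans (cong (concat₃ l ‼_) (+-assoc (length (l block₁)) (length (l block₂)) t))
        (trans (‼-++ʳ (l block₁) _ (length (l block₂) + t)) (‼-++ʳ (l block₂) (l block₃) t))

length-seqFrom : ∀ v n → length (seqFrom v n) ≡ n
length-seqFrom v zero    = refl
length-seqFrom v (suc n) = cong suc (length-seqFrom (suc v) n)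

seqFrom-‼ : ∀ v {n t} → t < n → seqFrom v n ‼ t ≡ v + t
seqFrom-‼ v {suc n} {zero}  _         = sym (+-identityʳ v)
seqFrom-‼ v {suc n} {suc t} (s≤s t<n) = trans (seqFrom-‼ (suc v) t<n) (sym (+-suc v t))

All-seqFrom : ∀ {P : ℕ → Set} v n → (∀ {p} → p < n → P (v + p)) → All P (seqFrom v n)
All-seqFrom     v zero    _      = []
All-seqFrom {P} v (suc n) P[v+_] =
  subst P (+-identityʳ v) (P[v+_] z<s) ∷ All-seqFrom (suc v) n (λ {p} p<n → subst P (+-suc v p) (P[v+_] (s<s p<n)))

∈-seqFrom : ∀ v {n p} → p < n → v + p ∈ seqFrom v n
∈-seqFrom v {suc n} {zero}  _         = here (+-identityʳ v)
∈-seqFrom v {suc n} {suc p} (s≤s p<n) = there (subst (_∈ seqFrom (suc v) n) (sym (+-suc v p)) (∈-seqFrom (suc v) p<n))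

length-twice : ∀ v n → length (twice (seqFrom v n)) ≡ double n
length-twice v zero    = refl
length-twice v (suc n) = cong (suc ∘ suc) (length-twice (suc v) n)

twice-‼ : ∀ v {n t} → t < double n → twice (seqFrom v n) ‼ t ≡ v + ⌊ t /2⌋
twice-‼ v {suc n} {zero}        _               = sym (+-identityʳ v)
twice-‼ v {suc n} {suc zero}    _               = sym (+-identityʳ v)
twice-‼ v {suc n} {suc (suc t)} (s≤s (s≤s t<n)) = trans (twice-‼ (suc v) t<n) (sym (+-suc v ⌊ t /2⌋))

hi∸v≡ : ∀ {v hi K} → suc hi ≡ v + suc K → hi ∸ v ≡ K
hi∸v≡ {v} {hi} {K} hi≡ = trans (cong (_∸ v) (suc-injective (trans hi≡ (+-suc v K)))) (m+n∸m≡n v K)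

length-wrapped : ∀ v {hi} N → suc hi ≡ v + N → length (wrapped (double N) v hi) ≡ double N
length-wrapped v zero    _   = refl
length-wrapped v (suc K) hi≡ rewrite hi∸v≡ hi≡ =
  cong suc (trans (length-++ (twice (seqFrom (suc v) K))) (trans (cong (_+ 1) (length-twice (suc v) K)) (+-comm (double K) 1)))

wrapped-‼ : ∀ v {hi N t} → suc hi ≡ v + N → t < double N → wrapped (double N) v hi ‼ t ≡ v + cyclicHalf N t
wrapped-‼ v {hi} {suc K} {zero}  _   _       = sym (+-identityʳ v)
wrapped-‼ v {hi} {suc K} {suc t} hi≡ (s≤s t<) rewrite hi∸v≡ hi≡ with m≤n⇒m<n∨m≡n (s≤s⁻¹ t<)
... | inj₁ t<2K = begin
  (body ++ v ∷ []) ‼ t          ≡⟨ ‼-++ˡ body (v ∷ []) (subst (t <_) (sym (length-twice (suc v) K)) t<2K) ⟩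
  body ‼ t                      ≡⟨ twice-‼ (suc v) t<2K ⟩
  suc v + ⌊ t /2⌋               ≡⟨ sym (+-suc v _) ⟩
  v + suc ⌊ t /2⌋               ≡⟨ cong (v +_) (sym (if-≡ᵇ-≢ (<⇒≢ t<2K ∘ suc-injective))) ⟩
  v + cyclicHalf (suc K) (suc t) ∎
  where
  open ≡-Reasoning
  body = twice (seqFrom (suc v) K)
... | inj₂ refl = begin
  (body ++ v ∷ []) ‼ double K            ≡⟨ cong ((body ++ v ∷ []) ‼_)
                                                    (sym (trans (+-identityʳ _) (length-twice (suc v) K))) ⟩
  (body ++ v ∷ []) ‼ (length body + 0)   ≡⟨ ‼-++ʳ body (v ∷ []) 0 ⟩
  v                                      ≡⟨ sym (+-identityʳ v) ⟩
  v + 0                                  ≡⟨ cong (v +_) (sym (cyclicHalf-last K)) ⟩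
  v + cyclicHalf (suc K) (suc (double K)) ∎
  where
  open ≡-Reasoning
  body = twice (seqFrom (suc v) K)

-- The construction

module Strategy (a b c : ℕ) (a≤b : a ≤ b) (b≤c : b ≤ c) (b+c≤3a : b + c ≤ 3 * a)
                (sum%4 : (a + b + c) % 4 ≡ 0 ⊎ (a + b + c) % 4 ≡ 1) where
  open Construction a b c
  open +-*-Solver

  private
    quot : ℕ
    quot = (a + b + c) / 4

    sum≡ : ∀ {r} → (a + b + c) % 4 ≡ r → a + b + c ≡ r + quot * 2 * 2
    sum≡ {r} sum%4≡r = trans (m≡m%n+[m/n]*n (a + b + c) 4) (cong₂ _+_ sum%4≡r (sym (*-assoc quot 2 2)))

    sum≤3c : a + b + c ≤ c + c + c
    sum≤3c = +-mono-≤ (+-mono-≤ (≤-trans a≤b b≤c) b≤c) ≤-refl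

  quarter : (a + b + c) % 4 ≡ 0 ⊎ (a + b + c) % 4 ≡ 1 → Σ[ m ∈ ℕ ] a + b + c' ≡ m * 4 × (c ≡ c' ⊎ c ≡ suc c')
  quarter (inj₁ sum%4≡0) = quot , trans (cong (a + b +_) c'≡c) (trans (sum≡ sum%4≡0) (*-assoc quot 2 2)) , inj₁ (sym c'≡c)
    where
    c'≡c : c' ≡ c
    c'≡c = if-≡ᵇ-≡ (trans (cong (_% 2) (sum≡ sum%4≡0)) (m*n%n≡0 (quot * 2) 2))
  quarter (inj₂ sum%4≡1) = quot , a+b+c'≡ , inj₂ (sym 1+c'≡c)
    where
    c'≡c∸1 : c' ≡ c ∸ 1
    c'≡c∸1 = if-≡ᵇ-≢ (λ sum%2≡0 → 1+n≢0 (trans (sym sum%2≡1) sum%2≡0))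
      where
      sum%2≡1 : (a + b + c) % 2 ≡ 1
      sum%2≡1 = trans (cong (_% 2) (sum≡ sum%4≡1)) ([m+kn]%n≡m%n 1 (quot * 2) 2)
    c≢0 : c ≢ 0
    c≢0 c≡0 = 1+n≢0 (trans (sym (sum≡ sum%4≡1)) (n≤0⇒n≡0 (subst (λ k → a + b + c ≤ k + k + k) c≡0 sum≤3c)))
    1+c'≡c : suc c' ≡ c
    1+c'≡c = trans (cong suc c'≡c∸1) (m+[n∸m]≡n (n≢0⇒n>0 c≢0))
    a+b+c'≡ : a + b + c' ≡ quot * 4
    a+b+c'≡ = suc-injective (begin
      suc (a + b + c')  ≡⟨ sym (+-suc (a + b) c') ⟩
      a + b + suc c'    ≡⟨ cong (a + b +_) 1+c'≡c ⟩
      a + b + c         ≡⟨ sum≡ sum%4≡1 ⟩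
      suc (quot * 2 * 2)   ≡⟨ cong suc (*-assoc quot 2 2) ⟩
      suc (quot * 4)       ∎)
      where open ≡-Reasoning

  m : ℕ
  m = proj₁ (quarter sum%4)

  a+b+c'≡m*4 : a + b + c' ≡ m * 4
  a+b+c'≡m*4 = proj₁ (proj₂ (quarter sum%4))

  c≡c'⊎1+c' : c ≡ c' ⊎ c ≡ suc c'
  c≡c'⊎1+c' = proj₂ (proj₂ (quarter sum%4))

  c'≤c : c' ≤ c
  c'≤c with c≡c'⊎1+c'
  ... | inj₁ c≡c'  = ≤-reflexive (sym c≡c')
  ... | inj₂ c≡1+c' = ≤-trans (n≤1+n c') (≤-reflexive (sym c≡1+c'))

  c≤1+c' : c ≤ suc c'
  c≤1+c' with c≡c'⊎1+c'
  ... | inj₁ c≡c'  = ≤-trans (≤-reflexive c≡c') (n≤1+n c')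
  ... | inj₂ c≡1+c' = ≤-reflexive c≡1+c'

  m≤a : m ≤ a
  m≤a = *-cancelʳ-≤ m a 4 (begin
    m * 4        ≡⟨ sym a+b+c'≡m*4 ⟩
    a + b + c'   ≤⟨ +-monoʳ-≤ (a + b) c'≤c ⟩
    a + b + c    ≡⟨ +-assoc a b c ⟩
    a + (b + c)  ≤⟨ +-monoʳ-≤ a b+c≤3a ⟩
    a + 3 * a    ≡⟨ solve 1 (λ a → a :+ con 3 :* a := a :* con 4) refl a ⟩
    a * 4        ∎)
    where open ≤-Reasoning

  m≤b : m ≤ b
  m≤b = ≤-trans m≤a a≤b

  m≤c' : m ≤ c'
  m≤c' with m ≤? c'
  ... | yes m≤c' = m≤c'
  ... | no  m≰c' = contradiction m*4<m*4 (<-irrefl refl)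
    where
    c'<m : c' < m
    c'<m = ≰⇒> m≰c'
    b≤m : b ≤ m
    b≤m = ≤-trans b≤c (≤-trans c≤1+c' c'<m)
    m*4<m*4 : m * 4 < m * 4
    m*4<m*4 = begin-strict
      m * 4          ≡⟨ sym a+b+c'≡m*4 ⟩
      a + b + c'     <⟨ +-mono-≤-< (+-mono-≤ (≤-trans a≤b b≤m) b≤m) c'<m ⟩
      m + m + m      ≤⟨ m≤m+n (m + m + m) m ⟩
      m + m + m + m  ≡⟨ solve 1 (λ m → m :+ m :+ m :+ m := m :* con 4) refl m ⟩
      m * 4          ∎
      where open ≤-Reasoning

  X Y Z : ℕ
  X = a ∸ m
  Y = b ∸ m
  Z = c' ∸ m

  X+m≡a : X + m ≡ a
  X+m≡a = m∸n+n≡m m≤a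

  Y+m≡b : Y + m ≡ b
  Y+m≡b = m∸n+n≡m m≤b

  Z+m≡c' : Z + m ≡ c'
  Z+m≡c' = m∸n+n≡m m≤c'

  X+Y+Z≡m : X + Y + Z ≡ m
  X+Y+Z≡m = +-cancelʳ-≡ (m * 3) (X + Y + Z) m (begin
    X + Y + Z + m * 3            ≡⟨ solve 4 (λ X Y Z m → X :+ Y :+ Z :+ m :* con 3 := (X :+ m) :+ (Y :+ m) :+ (Z :+ m))
                                            refl X Y Z m ⟩
    (X + m) + (Y + m) + (Z + m)  ≡⟨ cong₂ _+_ (cong₂ _+_ X+m≡a Y+m≡b) Z+m≡c' ⟩
    a + b + c'                   ≡⟨ a+b+c'≡m*4 ⟩
    m * 4                        ≡⟨ solve 1 (λ m → m :* con 4 := m :+ m :* con 3) refl m ⟩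
    m + m * 3                    ∎)
    where open ≡-Reasoning

  a≡ : a ≡ double X + Y + Z
  a≡ = begin
    a                 ≡⟨ sym X+m≡a ⟩
    X + m             ≡⟨ cong (X +_) (sym X+Y+Z≡m) ⟩
    X + (X + Y + Z)   ≡⟨ solve 3 (λ X Y Z → X :+ (X :+ Y :+ Z) := X :* con 2 :+ Y :+ Z) refl X Y Z ⟩
    X * 2 + Y + Z     ≡⟨ cong (λ d → d + Y + Z) (sym (double≡*2 X)) ⟩
    double X + Y + Z  ∎
    where open ≡-Reasoning

  b≡ : b ≡ X + double Y + Z
  b≡ = begin
    b                 ≡⟨ sym Y+m≡b ⟩
    Y + m             ≡⟨ cong (Y +_) (sym X+Y+Z≡m) ⟩
    Y + (X + Y + Z)   ≡⟨ solve 3 (λ X Y Z → Y :+ (X :+ Y :+ Z) := X :+ Y :* con 2 :+ Z) refl X Y Z ⟩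
    X + Y * 2 + Z     ≡⟨ cong (λ d → X + d + Z) (sym (double≡*2 Y)) ⟩
    X + double Y + Z  ∎
    where open ≡-Reasoning

  c'≡ : c' ≡ X + Y + double Z
  c'≡ = begin
    c'                ≡⟨ sym Z+m≡c' ⟩
    Z + m             ≡⟨ cong (Z +_) (sym X+Y+Z≡m) ⟩
    Z + (X + Y + Z)   ≡⟨ solve 3 (λ X Y Z → Z :+ (X :+ Y :+ Z) := X :+ Y :+ Z :* con 2) refl X Y Z ⟩
    X + Y + Z * 2     ≡⟨ cong (X + Y +_) (sym (double≡*2 Z)) ⟩
    X + Y + double Z  ∎
    where open ≡-Reasoning

  S≡m*2 : S ≡ m * 2
  S≡m*2 = trans (cong (_/ 2) (trans a+b+c'≡m*4 (sym (*-assoc m 2 2)))) (m*n/n≡m (m * 2) 2)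

  2*-∸S : ∀ {U v} → U + m ≡ v → 2 * v ∸ S ≡ double U
  2*-∸S {U} {v} U+m≡v = begin
    2 * v ∸ S              ≡⟨ cong₂ (λ v S → 2 * v ∸ S) (sym U+m≡v) S≡m*2 ⟩
    2 * (U + m) ∸ m * 2    ≡⟨ cong (_∸ m * 2) (solve 2 (λ U m → con 2 :* (U :+ m) := U :* con 2 :+ m :* con 2) refl U m) ⟩
    U * 2 + m * 2 ∸ m * 2  ≡⟨ m+n∸n≡m (U * 2) (m * 2) ⟩
    U * 2                  ≡⟨ sym (double≡*2 U) ⟩
    double U               ∎
    where open ≡-Reasoning

  x≡ : x ≡ double X
  x≡ = 2*-∸S X+m≡a

  y≡ : y ≡ double Y
  y≡ = 2*-∸S Y+m≡b

  z≡ : z ≡ double Z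
  z≡ = 2*-∸S Z+m≡c'

  x/2≡ : x / 2 ≡ X
  x/2≡ = trans (cong (_/ 2) x≡) (double/2 X)

  y/2≡ : y / 2 ≡ Y
  y/2≡ = trans (cong (_/ 2) y≡) (double/2 Y)

  size : Block → ℕ
  size block₁ = X
  size block₂ = Y
  size block₃ = Z

  width₁ width₂ width₃ : Block → ℕ
  width₁ block₁ = double X
  width₁ block₂ = Y
  width₁ block₃ = Z
  width₂ block₁ = X
  width₂ block₂ = double Y
  width₂ block₃ = Z
  width₃ block₁ = X
  width₃ block₂ = Y
  width₃ block₃ = double Z

  column₁ column₂ column₃ : Block → List ℕ
  column₁ block₁ = seqFrom 1 (double X)
  column₁ block₂ = twice (seqFrom (double X + 1) Y)
  column₁ block₃ = twice (seqFrom (double X + Y + 1) Z)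
  column₂ block₁ = twice (seqFrom 1 X)
  column₂ block₂ = seqFrom (X + 1) (double Y)
  column₂ block₃ = wrapped (double Z) (X + double Y + 1) b
  column₃ block₁ = wrapped (double X) 1 X
  column₃ block₂ = wrapped (double Y) (X + 1) (X + Y)
  column₃ block₃ = seqFrom (X + Y + 1) (double Z)

  list₁≡ : list₁ ≡ concat₃ column₁
  list₁≡ = shape x≡ y/2≡ (trans (cong₂ _∸_ a≡ (cong₂ _+_ x≡ y/2≡)) (m+n∸m≡n (double X + Y) Z))
    where
    shape : ∀ {x₁ Y₁ Z₁} → x₁ ≡ double X → Y₁ ≡ Y → Z₁ ≡ Z →
      seqFrom 1 x₁ ++ twice (seqFrom (x₁ + 1) Y₁) ++ twice (seqFrom (x₁ + Y₁ + 1) Z₁) ≡ concat₃ column₁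
    shape refl refl refl = refl

  list₂≡ : list₂ ≡ concat₃ column₂
  list₂≡ = shape x/2≡ y≡ z≡
    where
    shape : ∀ {X₁ y₁ z₁} → X₁ ≡ X → y₁ ≡ double Y → z₁ ≡ double Z →
      twice (seqFrom 1 X₁) ++ seqFrom (X₁ + 1) y₁ ++ wrapped z₁ (X₁ + y₁ + 1) b ≡ concat₃ column₂
    shape refl refl refl = refl

  list₃≡ : list₃ ≡ concat₃ column₃
  list₃≡ = shape x≡ x/2≡ y≡ y/2≡ (trans (cong₂ _∸_ c'≡ (cong₂ _+_ x/2≡ y/2≡)) (m+n∸m≡n (X + Y) (double Z)))
    where
    shape : ∀ {x₁ X₁ y₁ Y₁ W₁} → x₁ ≡ double X → X₁ ≡ X → y₁ ≡ double Y → Y₁ ≡ Y → W₁ ≡ double Z →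
      wrapped x₁ 1 X₁ ++ wrapped y₁ (X₁ + 1) (X₁ + Y₁) ++ seqFrom (X₁ + Y₁ + 1) W₁ ≡ concat₃ column₃
    shape refl refl refl refl refl = refl

  1+b≡ : suc b ≡ X + double Y + 1 + Z
  1+b≡ = trans (cong suc b≡) (1+[m+n]≡m+1+n (X + double Y) Z)

  length-column₁ : ∀ B → length (column₁ B) ≡ double (size B)
  length-column₁ block₁ = length-seqFrom 1 (double X)
  length-column₁ block₂ = length-twice (double X + 1) Y
  length-column₁ block₃ = length-twice (double X + Y + 1) Z

  length-column₂ : ∀ B → length (column₂ B) ≡ double (size B)
  length-column₂ block₁ = length-twice 1 X
  length-column₂ block₂ = length-seqFrom (X + 1) (double Y)
  length-column₂ block₃ = length-wrapped (X + double Y + 1) Z 1+b≡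

  length-column₃ : ∀ B → length (column₃ B) ≡ double (size B)
  length-column₃ block₁ = length-wrapped 1 X refl
  length-column₃ block₂ = length-wrapped (X + 1) Y (1+[m+n]≡m+1+n X Y)
  length-column₃ block₃ = length-seqFrom (X + Y + 1) (double Z)

  position : Block → ℕ → ℕ
  position B t = offset (double ∘ size) B + t

  pattern₁ pattern₂ pattern₃ : Block → ℕ → ℕ
  pattern₁ block₁ = id
  pattern₁ block₂ = ⌊_/2⌋
  pattern₁ block₃ = ⌊_/2⌋
  pattern₂ block₁ = ⌊_/2⌋
  pattern₂ block₂ = id
  pattern₂ block₃ = cyclicHalf Z
  pattern₃ block₁ = cyclicHalf X
  pattern₃ block₂ = cyclicHalf Y
  pattern₃ block₃ = id

  pattern₁-< : ∀ B {t} → t < double (size B) → pattern₁ B t < width₁ B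
  pattern₁-< block₁ t<n = t<n
  pattern₁-< block₂ t<n = ⌊/2⌋-< t<n
  pattern₁-< block₃ t<n = ⌊/2⌋-< t<n

  pattern₂-< : ∀ B {t} → t < double (size B) → pattern₂ B t < width₂ B
  pattern₂-< block₁ t<n = ⌊/2⌋-< t<n
  pattern₂-< block₂ t<n = t<n
  pattern₂-< block₃ t<n = cyclicHalf-< t<n

  pattern₃-< : ∀ B {t} → t < double (size B) → pattern₃ B t < width₃ B
  pattern₃-< block₁ t<n = cyclicHalf-< t<n
  pattern₃-< block₂ t<n = cyclicHalf-< t<n
  pattern₃-< block₃ t<n = t<n

  column₁-‼ : ∀ B {t} → t < double (size B) → column₁ B ‼ t ≡ offset width₁ B + 1 + pattern₁ B t
  column₁-‼ block₁ t<n = seqFrom-‼ 1 t<n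
  column₁-‼ block₂ t<n = twice-‼ (double X + 1) t<n
  column₁-‼ block₃ t<n = twice-‼ (double X + Y + 1) t<n

  column₂-‼ : ∀ B {t} → t < double (size B) → column₂ B ‼ t ≡ offset width₂ B + 1 + pattern₂ B t
  column₂-‼ block₁ t<n = twice-‼ 1 t<n
  column₂-‼ block₂ t<n = seqFrom-‼ (X + 1) t<n
  column₂-‼ block₃ t<n = wrapped-‼ (X + double Y + 1) 1+b≡ t<n

  column₃-‼ : ∀ B {t} → t < double (size B) → column₃ B ‼ t ≡ offset width₃ B + 1 + pattern₃ B t
  column₃-‼ block₁ t<n = wrapped-‼ 1 refl t<n
  column₃-‼ block₂ t<n = wrapped-‼ (X + 1) (1+[m+n]≡m+1+n X Y) t<n
  column₃-‼ block₃ t<n = seqFrom-‼ (X + Y + 1) t<n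

  list₁-‼ : ∀ B {t} → t < double (size B) → list₁ ‼ position B t ≡ offset width₁ B + 1 + pattern₁ B t
  list₁-‼ B t<n =
    trans (cong (_‼ position B _) list₁≡) (trans (‼-concat₃ column₁ length-column₁ B t<n) (column₁-‼ B t<n))

  list₂-‼ : ∀ B {t} → t < double (size B) → list₂ ‼ position B t ≡ offset width₂ B + 1 + pattern₂ B t
  list₂-‼ B t<n =
    trans (cong (_‼ position B _) list₂≡) (trans (‼-concat₃ column₂ length-column₂ B t<n) (column₂-‼ B t<n))

  list₃-‼ : ∀ B {t} → t < double (size B) → list₃ ‼ position B t ≡ offset width₃ B + 1 + pattern₃ B t
  list₃-‼ B t<n =
    trans (cong (_‼ position B _) list₃≡) (trans (‼-concat₃ column₃ length-column₃ B t<n) (column₃-‼ B t<n))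

  Locations : Triple → Set
  Locations (s₁ , s₂ , s₃) = Inside width₁ s₁ × Inside width₂ s₂ × Located width₃ s₃

  locations : ∀ {s} → InBox a b c s → Locations s
  locations ((1≤s₁ , s₁≤a) , (1≤s₂ , s₂≤b) , (1≤s₃ , s₃≤c)) =
    locate width₁ 1≤s₁ (subst (_ ≤_) a≡ s₁≤a) ,
    locate width₂ 1≤s₂ (subst (_ ≤_) b≡ s₂≤b) ,
    locate⁺ width₃ 1≤s₃ (subst (λ k → _ ≤ suc k) c'≡ (≤-trans s₃≤c c≤1+c'))

  local : ∀ {s} → Locations s → Block → Local
  local (l₁ , l₂ , l₃) block₁ = slot block₁ l₁ , slot block₁ l₂ , slot⁺ block₁ l₃
  local (l₁ , l₂ , l₃) block₂ = slot block₂ l₂ , slot block₂ l₁ , slot⁺ block₂ l₃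
  local (l₁ , l₂ , l₃) block₃ = slot⁺ block₃ l₃ , slot block₃ l₁ , slot block₃ l₂

  placement : ∀ {s} → Locations s → Placement
  placement (l₁ , l₂ , l₃) = blockOf l₁ , blockOf l₂ , blockOf⁺ l₃

  local-valid : ∀ {s} (ls : Locations s) B → Valid (size B) (local ls B)
  local-valid (l₁ , l₂ , l₃) block₁ = slot-valid block₁ l₁ , slot-valid block₁ l₂ , slot⁺-valid block₁ l₃
  local-valid (l₁ , l₂ , l₃) block₂ = slot-valid block₂ l₂ , slot-valid block₂ l₁ , slot⁺-valid block₂ l₃
  local-valid (l₁ , l₂ , l₃) block₃ = slot⁺-valid block₃ l₃ , slot-valid block₃ l₁ , slot-valid block₃ l₂

  present-local : ∀ {s} (ls : Locations s) B → present (local ls B) ≡ rolesIn B (placement ls)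
  present-local (l₁ , l₂ , l₃) block₁ =
    cong₂ _,_ (is-just-slot block₁ l₁) (cong₂ _,_ (is-just-slot block₁ l₂) (is-just-slot⁺ block₁ l₃))
  present-local (l₁ , l₂ , l₃) block₂ =
    cong₂ _,_ (is-just-slot block₂ l₂) (cong₂ _,_ (is-just-slot block₂ l₁) (is-just-slot⁺ block₂ l₃))
  present-local (l₁ , l₂ , l₃) block₃ =
    cong₂ _,_ (is-just-slot⁺ block₃ l₃) (cong₂ _,_ (is-just-slot block₃ l₁) (is-just-slot block₃ l₂))

  question : ℕ → Triple
  question p = list₁ ‼ p , list₂ ‼ p , list₃ ‼ p

  g-question : ∀ {s} (ls : Locations s) B {t} → t < double (size B) →
    g s (question (position B t)) ≡ score (size B) (local ls B) t
  g-question {s₁ , s₂ , s₃} (l₁ , l₂ , l₃) B {t} t<n =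
    trans (cong₂ _+_ (cong₂ _+_ hit₁ hit₂) hit₃) (arrange B)
    where
    hit₁ : eqInd s₁ (list₁ ‼ position B t) ≡ hits (slot B l₁) (pattern₁ B t)
    hit₁ = trans (cong (eqInd s₁) (list₁-‼ B t<n)) (slot-eqInd B l₁ (pattern₁-< B t<n))
    hit₂ : eqInd s₂ (list₂ ‼ position B t) ≡ hits (slot B l₂) (pattern₂ B t)
    hit₂ = trans (cong (eqInd s₂) (list₂-‼ B t<n)) (slot-eqInd B l₂ (pattern₂-< B t<n))
    hit₃ : eqInd s₃ (list₃ ‼ position B t) ≡ hits (slot⁺ B l₃) (pattern₃ B t)
    hit₃ = trans (cong (eqInd s₃) (list₃-‼ B t<n)) (slot⁺-eqInd B l₃ (pattern₃-< B t<n))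
    arrange : ∀ B → hits (slot B l₁) (pattern₁ B t) + hits (slot B l₂) (pattern₂ B t) + hits (slot⁺ B l₃) (pattern₃ B t)
                  ≡ score (size B) (local (l₁ , l₂ , l₃) B) t
    arrange block₁ = refl
    arrange block₂ = cong (_+ hits (slot⁺ block₂ l₃) (cyclicHalf Y t))
                          (+-comm (hits (slot block₂ l₁) ⌊ t /2⌋) (hits (slot block₂ l₂) t))
    arrange block₃ = trans (+-comm (hits (slot block₃ l₁) ⌊ t /2⌋ + hits (slot block₃ l₂) (cyclicHalf Z t))
                                   (hits (slot⁺ block₃ l₃) t))
                           (sym (+-assoc (hits (slot⁺ block₃ l₃) t) (hits (slot block₃ l₁) ⌊ t /2⌋)
                                         (hits (slot block₃ l₂) (cyclicHalf Z t))))

  questions : ℕ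
  questions = total (double ∘ size)

  position<questions : ∀ B {t} → t < double (size B) → position B t < questions
  position<questions B t<n = ≤-trans (+-monoʳ-< (offset (double ∘ size) B) t<n) (end≤total (double ∘ size) B)

  reconstruct : ∀ {s s'} (ls : Locations s) (ls' : Locations s') → (∀ B → local ls B ≡ local ls' B) → s ≡ s'
  reconstruct {_ , _ , _} {_ , _ , _} (l₁ , l₂ , l₃) (l₁' , l₂' , l₃') same =
    cong₂ _,_ (inside-injective l₁ l₁' slots₁)
              (cong₂ _,_ (inside-injective l₂ l₂' slots₂) (located-injective l₃ l₃' slots₃))
    where
    slots₁ : ∀ B → slot B l₁ ≡ slot B l₁'
    slots₁ block₁ = cong proj₁ (same block₁)
    slots₁ block₂ = cong (proj₁ ∘ proj₂) (same block₂)
    slots₁ block₃ = cong (proj₁ ∘ proj₂) (same block₃)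
    slots₂ : ∀ B → slot B l₂ ≡ slot B l₂'
    slots₂ block₁ = cong (proj₁ ∘ proj₂) (same block₁)
    slots₂ block₂ = cong proj₁ (same block₂)
    slots₂ block₃ = cong (proj₂ ∘ proj₂) (same block₃)
    slots₃ : ∀ B → slot⁺ B l₃ ≡ slot⁺ B l₃'
    slots₃ block₁ = cong (proj₂ ∘ proj₂) (same block₁)
    slots₃ block₂ = cong (proj₂ ∘ proj₂) (same block₂)
    slots₃ block₃ = cong proj₁ (same block₃)

  module _ {s s'} (ls : Locations s) (ls' : Locations s') (agree : ∀ B → local ls B ≈[ size B ] local ls' B) where

    same-weight : ∀ B → weight (rolesIn B (placement ls)) ≡ weight (rolesIn B (placement ls'))
    same-weight B = subst₂ (λ r r' → weight r ≡ weight r') (present-local ls B) (present-local ls' B)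
                           (≈⇒same-weight (local-valid ls B) (local-valid ls' B) (agree B))

    same-placement⇒≡ : placement ls ≡ placement ls' → s ≡ s'
    same-placement⇒≡ same-placement = reconstruct ls ls' λ B →
      same-presence⇒≡ (local-valid ls B) (local-valid ls' B) (agree B)
        (trans (present-local ls B) (trans (cong (rolesIn B) same-placement) (sym (present-local ls' B))))

    swapped⇒size≡1 : (∀ B → Swapped (rolesIn B (placement ls)) (rolesIn B (placement ls'))) → ∀ B → size B ≡ 1
    swapped⇒size≡1 swapped B = swapped⇒N≡1 (local-valid ls B) (local-valid ls' B) (agree B)
      (subst₂ Swapped (sym (present-local ls B)) (sym (present-local ls' B)) (swapped B))

    agreement⇒≡ : ¬ (X ≡ 1 × Y ≡ 1 × Z ≡ 1) → s ≡ s'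
    agreement⇒≡ not-all-1 with placement-determined (placement ls) (placement ls') same-weight
    ... | inj₁ same-placement = same-placement⇒≡ same-placement
    ... | inj₂ swapped        = contradiction (size≡1 block₁ , size≡1 block₂ , size≡1 block₃) not-all-1
      where
      size≡1 : ∀ B → size B ≡ 1
      size≡1 = swapped⇒size≡1 swapped

  not-all-1 : (a , b , c) ≢ (4 , 4 , 4) → (a , b , c) ≢ (4 , 4 , 5) → ¬ (X ≡ 1 × Y ≡ 1 × Z ≡ 1)
  not-all-1 ≢444 ≢445 (X≡1 , Y≡1 , Z≡1) =
    [ (λ c≡c'   → ≢444 (cong₂ _,_ a≡4 (cong₂ _,_ b≡4 (trans c≡c' c'≡4))))
    , (λ c≡1+c' → ≢445 (cong₂ _,_ a≡4 (cong₂ _,_ b≡4 (trans c≡1+c' (cong suc c'≡4)))))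
    ] c≡c'⊎1+c'
    where
    a≡4 : a ≡ 4
    a≡4 = trans a≡ (cong₂ _+_ (cong₂ _+_ (cong double X≡1) Y≡1) Z≡1)
    b≡4 : b ≡ 4
    b≡4 = trans b≡ (cong₂ _+_ (cong₂ _+_ X≡1 (cong double Y≡1)) Z≡1)
    c'≡4 : c' ≡ 4
    c'≡4 = trans c'≡ (cong₂ _+_ (cong₂ _+_ X≡1 Y≡1) (cong double Z≡1))

  position-of : ∀ {p} → p < questions → Σ[ B ∈ Block ] Σ[ t ∈ ℕ ] t < double (size B) × p ≡ position B t
  position-of p<n with inside-split (locate (double ∘ size) (s≤s z≤n) p<n)
  ... | B , t , t<n , 1+p≡ = B , t , t<n , suc-injective (trans 1+p≡ (sym (1+[m+n]≡m+1+n (offset (double ∘ size) B) t)))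

  block-question-in-box : ∀ B {t} → t < double (size B) → InBox a b c (question (position B t))
  block-question-in-box B t<n =
    subst (λ u → 1 ≤ u × u ≤ a) (sym (list₁-‼ B t<n)) (in-window width₁ B (pattern₁-< B t<n) (≤-reflexive (sym a≡))) ,
    subst (λ u → 1 ≤ u × u ≤ b) (sym (list₂-‼ B t<n)) (in-window width₂ B (pattern₂-< B t<n) (≤-reflexive (sym b≡))) ,
    subst (λ u → 1 ≤ u × u ≤ c) (sym (list₃-‼ B t<n))
          (in-window width₃ B (pattern₃-< B t<n) (≤-trans (≤-reflexive (sym c'≡)) c'≤c))

  question-in-box : ∀ {p} → p < questions → InBox a b c (question p)
  question-in-box p<n = at (position-of p<n)
    where
    at : ∀ {p} → Σ[ B ∈ Block ] Σ[ t ∈ ℕ ] t < double (size B) × p ≡ position B t → InBox a b c (question p)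
    at (B , t , t<n , refl) = block-question-in-box B t<n

  entry≡‼ : ∀ l k → entry l k ≡ l ‼ k
  entry≡‼ []      k       = refl
  entry≡‼ (v ∷ l) zero    = refl
  entry≡‼ (v ∷ l) (suc k) = entry≡‼ l k

  q≡question : ∀ p → q (suc p) ≡ question p
  q≡question p = cong₂ _,_ (entry≡‼ list₁ p) (cong₂ _,_ (entry≡‼ list₂ p) (entry≡‼ list₃ p))

  x+y+z≡questions : x + y + z ≡ questions
  x+y+z≡questions = cong₂ _+_ (cong₂ _+_ x≡ y≡) z≡

  is-strategy : IsStrategy a b c Q
  is-strategy = map⁺ (All-seqFrom 1 (x + y + z) λ {p} p<n →
    subst (InBox a b c) (sym (q≡question p)) (question-in-box (subst (p <_) x+y+z≡questions p<n)))

  feasible : ¬ (X ≡ 1 × Y ≡ 1 × Z ≡ 1) → Feasible a b c Q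
  feasible not-all-1 s s' box box' s≢s' with All.all? (λ q → g s q ≟ g s' q) Q
  ... | no ¬same = find (¬All⇒Any¬ (λ q → g s q ≟ g s' q) Q ¬same)
  ... | yes same = contradiction (agreement⇒≡ (locations box) (locations box') agree not-all-1) s≢s'
    where
    same-answer : ∀ {p} → p < questions → g s (question p) ≡ g s' (question p)
    same-answer {p} p<n = subst (λ u → g s u ≡ g s' u) (q≡question p)
      (All.lookup same (∈-map⁺ q (∈-seqFrom 1 (subst (p <_) (sym x+y+z≡questions) p<n))))
    agree : ∀ B → local (locations box) B ≈[ size B ] local (locations box') B
    agree B t<n = trans (sym (g-question (locations box) B t<n))
                        (trans (same-answer (position<questions B t<n)) (g-question (locations box') B t<n))

lemma6 : (a b c : ℕ) → a ≤ b → b ≤ c → b + c ≤ 3 * a →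
    ((a + b + c) % 4 ≡ 0 ⊎ (a + b + c) % 4 ≡ 1) →
    (a , b , c) ≢ (4 , 4 , 4) → (a , b , c) ≢ (4 , 4 , 5) →
    IsStrategy a b c (Construction.Q a b c) × Feasible a b c (Construction.Q a b c)
lemma6 a b c a≤b b≤c b+c≤3a sum%4 ≢444 ≢445 = is-strategy , feasible (not-all-1 ≢444 ≢445)
  where open Strategy a b c a≤b b≤c b+c≤3a sum%4
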